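{- Let $G$ be a graph that is $2$-connected, non-bipartite, and embedded in a surface by a parity-consistent embedding. Then there exists an alternating orientation of the dual graph of $G$.
   Context: A simple closed curve in a surface is $1$-sided if it has a neighborhood homeomorphic to a Möbius strip and $2$-sided otherwise; a cycle of an embedded graph is $1$-/$2$-sided accordingly. A closed walk, regarded as an Eulerian multigraph and decomposed into edge-disjoint cycles, is $1$-sided if an odd number of these cycles are $1$-sided (independent of the decomposition). An embedding is parity-consistent if it is cellular (every face homeomorphic to an open disk) and every odd closed walk is $1$-sided. The dual graph has a node per face of $G$ and an edge per edge of $G$ joining the faces on its two sides; the facial walk of a face $f$ induces a cyclic order on the dual edges at $f$. An orientation of the dual graph is alternating if, at every dual node $f$, the dual edges in this cyclic order alternately leave and enter $f$. -}

module Defs where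

-- Graphs cellularly embedded in closed surfaces, encoded combinatorially as
-- generalized maps (graph-encoded maps / "gems", Lins; Bryant–Singerman):
-- a finite set of flags with three fixed-point-free involutions τ0, τ1, τ2,
-- τ0 τ2 = τ2 τ0 fixed-point-free, acting transitively.  Every cellular embedding
-- of a connected graph in a closed surface is described by such a map and
-- conversely.  Vertices of G = ⟨τ1,τ2⟩-orbits, edges = ⟨τ0,τ2⟩-orbits,
-- faces = ⟨τ0,τ1⟩-orbits.  A flag x is an (end, side) of an edge: x and τ0 x
-- are the two ends of the same edge on the same side, x and τ2 x are the same
-- end on the two sides, and τ1 moves to the next edge around the current face.

open import Data.Nat using (ℕ; _≤_; _%_)
open import Data.Fin using (Fin)
open import Data.Bool using (Bool; true; false; not; _xor_; _∧_)
open import Data.List using (List; []; _∷_; length; map; foldr)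
open import Data.Product using (Σ; ∃; _×_; _,_)
open import Relation.Binary.PropositionalEquality using (_≡_; _≢_)
open import Relation.Nullary using (¬_)

data Gen : Set where
  g0 g1 g2 : Gen

module _ {N : ℕ} (act : Gen → Fin N → Fin N) (A : Gen → Bool) where
  data Orbit : Fin N → Fin N → Set where
    here : ∀ {x} → Orbit x x
    step : ∀ {x y} (g : Gen) → A g ≡ true → Orbit (act g x) y → Orbit x y

vertGen : Gen → Bool
vertGen g0 = false
vertGen g1 = true
vertGen g2 = true

edgeGen : Gen → Bool
edgeGen g0 = true
edgeGen g1 = false
edgeGen g2 = true

allGen : Gen → Bool
allGen _ = true

act3 : ∀ {N : ℕ} (t0 t1 t2 : Fin N → Fin N) → Gen → Fin N → Fin N
act3 t0 t1 t2 g0 = t0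
act3 t0 t1 t2 g1 = t1
act3 t0 t1 t2 g2 = t2

record Map (n m : ℕ) : Set where
  field
    N  : ℕ
    τ0 τ1 τ2 : Fin N → Fin N
    τ0-inv : ∀ x → τ0 (τ0 x) ≡ x
    τ1-inv : ∀ x → τ1 (τ1 x) ≡ x
    τ2-inv : ∀ x → τ2 (τ2 x) ≡ x
    τ0-fpf : ∀ x → τ0 x ≢ x
    τ1-fpf : ∀ x → τ1 x ≢ x
    τ2-fpf : ∀ x → τ2 x ≢ x
    τ02-comm : ∀ x → τ0 (τ2 x) ≡ τ2 (τ0 x)
    τ02-fpf : ∀ x → τ0 (τ2 x) ≢ x
    connected : ∀ x y → Orbit (act3 τ0 τ1 τ2) allGen x y
    vert : Fin N → Fin n
    vert-τ1 : ∀ x → vert (τ1 x) ≡ vert x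
    vert-τ2 : ∀ x → vert (τ2 x) ≡ vert x
    vert-orb : ∀ x y → vert x ≡ vert y → Orbit (act3 τ0 τ1 τ2) vertGen x y
    vert-surj : ∀ v → ∃ λ x → vert x ≡ v
    edge : Fin N → Fin m
    edge-τ0 : ∀ x → edge (τ0 x) ≡ edge x
    edge-τ2 : ∀ x → edge (τ2 x) ≡ edge x
    edge-orb : ∀ x y → edge x ≡ edge y → Orbit (act3 τ0 τ1 τ2) edgeGen x y
    edge-surj : ∀ e → ∃ λ x → edge x ≡ e

module _ {n m : ℕ} (M : Map n m) where
  open Map M

  -- the edge with flag x joins vert x and vert (τ0 x)
  Loopless : Set
  Loopless = ∀ x → vert (τ0 x) ≢ vert x

  -- paths in G - w starting at u and ending at v (all vertices ≠ w if u ≠ w)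
  data ReachAvoid (w : Fin n) : Fin n → Fin n → Set where
    here : ∀ {u} → ReachAvoid w u u
    step : ∀ {u v} (x : Fin N) → vert x ≡ u → vert (τ0 x) ≢ w →
           ReachAvoid w (vert (τ0 x)) v → ReachAvoid w u v

  TwoConnected : Set
  TwoConnected = (3 ≤ n) × (∀ w u v → u ≢ w → v ≢ w → ReachAvoid w u v)

  Bipartite : Set
  Bipartite = Σ (Fin n → Bool) λ c → ∀ x → c (vert x) ≢ c (vert (τ0 x))

  -- closed walks: a nonempty list of flags x₁ … x_k; step i traverses the
  -- edge of x_i from vert x_i to vert (τ0 x_i), and consecutive steps (cyclically)
  -- must link up.
  LinksTo : Fin n → Fin N → List (Fin N) → Set
  LinksTo v x [] = vert (τ0 x) ≡ v
  LinksTo v x (y ∷ ys) = (vert (τ0 x) ≡ vert y) × LinksTo v y ys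

  record ClosedWalk : Set where
    field
      first : Fin N
      rest  : List (Fin N)
      links : LinksTo (vert first) first rest
    steps : List (Fin N)
    steps = first ∷ rest

  OddWalk : ClosedWalk → Set
  OddWalk W = length (ClosedWalk.steps W) % 2 ≡ 1

  -- a local orientation at every vertex: a 2-colouring of the flags at each
  -- vertex that alternates around the vertex
  LocalOrientation : Set
  LocalOrientation = Σ (Fin N → Bool) λ σ →
    (∀ x → σ (τ1 x) ≡ not (σ x)) × (∀ x → σ (τ2 x) ≡ not (σ x))

  -- traversing the edge of x is orientation-reversing (twisted) w.r.t. σ
  twisted : (Fin N → Bool) → Fin N → Bool
  twisted σ x = not (σ x xor σ (τ0 x))

  parity : List Bool → Bool
  parity = foldr _xor_ false

  -- 1-sided: odd number of twisted edge traversals (independent of σ and of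
  -- the chosen flags); for a cycle this is exactly having a Möbius-strip
  -- neighbourhood, and it is additive over cycle decompositions.
  OneSided : ClosedWalk → Set
  OneSided W = ∀ (lo : LocalOrientation) →
    parity (map (twisted (Data.Product.proj₁ lo)) (ClosedWalk.steps W)) ≡ true

  -- cellularity is built into the map encoding
  ParityConsistent : Set
  ParityConsistent = ∀ (W : ClosedWalk) → OddWalk W → OneSided W

  -- orientation of the dual graph: dual edge e joins the faces on the two sides
  -- of e; the sides of e are the τ0-pairs {x, τ0 x} among the flags of e.
  -- An orientation marks, for each edge, the side at which the dual edge
  -- leaves ("true") ; the other side is where it enters.
  record DualOrientation : Set where
    field
      leaves : Fin N → Bool
      leaves-τ0 : ∀ x → leaves (τ0 x) ≡ leaves x
      leaves-τ2 : ∀ x → leaves (τ2 x) ≡ not (leaves x)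

  -- around a face, consecutive sides (dual edge occurrences) in the facial
  -- walk are {x, τ0 x} and {τ1 x, τ0 τ1 x}; alternation means leaving and
  -- entering alternate along this cyclic order.
  Alternating : DualOrientation → Set
  Alternating o = ∀ x → DualOrientation.leaves o (τ1 x) ≡ not (DualOrientation.leaves o x)

{-# OPTIONS --safe #-}
module Submission where

-- Fix a local orientation σ; it exists because the ⟨τ1,τ2⟩-orbits of flags
-- are even cycles.  Call an edge traversal untwisted when σ differs at its two
-- ends.  Parity-consistency says that an odd closed walk has an odd number of
-- twisted, hence an even number of untwisted, traversals; splicing a fixed odd
-- closed walk (G is not bipartite) into an even one extends this to all closed
-- walks.  So "untwisted" is a coboundary: some pot on the vertices changes
-- exactly along untwisted edges.  Reversing σ at the vertices where pot is true
-- makes every edge twisted, and a local orientation in which every edge is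
-- twisted is precisely an alternating orientation of the dual graph.

open import Defs
open import Data.Nat using (ℕ; zero; suc; _%_)
open import Data.Fin using (Fin)
open import Data.Fin.Properties using (¬Fin0)
open import Data.Bool using (Bool; true; false; not; _xor_)
open import Data.Bool.Properties
  using (_≟_; not-involutive; not-injective; not-¬; ¬-not;
         not-distribˡ-xor; not-distribʳ-xor; xor-assoc; xor-comm; xor-identityʳ)
open import Data.List using (List; []; _∷_; length; map)
open import Data.Product using (Σ; module Σ; _,_; proj₁; proj₂)
open import Data.Empty using (⊥-elim)
open import Relation.Binary.PropositionalEquality
open import Relation.Nullary using (¬_)
open import Relation.Nullary.Decidable using (decidable-stable)

xor≡false⇒≡ : ∀ {x y} → x xor y ≡ false → x ≡ y
xor≡false⇒≡ {false} {false} _ = refl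
xor≡false⇒≡ {true}  {true}  _ = refl

not-xor-swap : ∀ x y → not x xor y ≡ x xor not y
not-xor-swap x y = trans (sym (not-distribˡ-xor x y)) (not-distribʳ-xor x y)

xor-cancel-outer : ∀ a b c → b xor (c xor (a xor b)) ≡ a xor c
xor-cancel-outer false false false = refl
xor-cancel-outer false false true  = refl
xor-cancel-outer false true  false = refl
xor-cancel-outer false true  true  = refl
xor-cancel-outer true  false false = refl
xor-cancel-outer true  false true  = refl
xor-cancel-outer true  true  false = refl
xor-cancel-outer true  true  true  = refl

module Dihedral {X : Set} (a b : X → X)
  (a-inv : ∀ x → a (a x) ≡ x) (b-inv : ∀ x → b (b x) ≡ x)
  (a-fpf : ∀ x → a x ≢ x) (b-fpf : ∀ x → b x ≢ x) where

  r s : X → X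
  r x = a (b x)
  s x = b (a x)

  _^_ : (X → X) → ℕ → X → X
  (f ^ zero) x = x
  (f ^ suc k) x = f ((f ^ k) x)

  ^-comm : ∀ f k x → (f ^ k) (f x) ≡ f ((f ^ k) x)
  ^-comm f zero x = refl
  ^-comm f (suc k) x = cong f (^-comm f k x)

  s-r : ∀ x → s (r x) ≡ x
  s-r x = trans (cong b (a-inv (b x))) (b-inv x)

  a-r^ : ∀ k x → a ((r ^ k) x) ≡ (s ^ k) (a x)
  a-r^ zero x = refl
  a-r^ (suc k) x =
    trans (a-inv _) (trans (cong b (sym (a-inv _))) (cong s (a-r^ k x)))

  a-s^ : ∀ k x → a ((s ^ k) x) ≡ (r ^ k) (a x)
  a-s^ zero x = refl
  a-s^ (suc k) x = cong r (a-s^ k x)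

  b-r^ : ∀ k x → b ((r ^ k) x) ≡ (s ^ k) (b x)
  b-r^ zero x = refl
  b-r^ (suc k) x = cong s (b-r^ k x)

  b-s^ : ∀ k x → b ((s ^ k) x) ≡ (r ^ k) (b x)
  b-s^ zero x = refl
  b-s^ (suc k) x =
    trans (b-inv _) (trans (cong a (sym (b-inv _))) (cong r (b-s^ k x)))

  a^ : Bool → X → X
  a^ false x = x
  a^ true  x = a x

  a-a^ : ∀ c x → a (a^ c x) ≡ a^ (not c) x
  a-a^ false x = refl
  a-a^ true  x = a-inv x

  -- Normal forms r^k a^c, s^k a^c of the elements of ⟨a, b⟩ (s = r⁻¹);
  -- appending a or b to a word flips c, so c is the parity of its length.
  data Word (c : Bool) (x y : X) : Set where
    r-word : ∀ k → y ≡ (r ^ k) (a^ c x) → Word c x y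
    s-word : ∀ k → y ≡ (s ^ k) (a^ c x) → Word c x y

  word-refl : ∀ x → Word false x x
  word-refl x = r-word 0 refl

  word-a : ∀ {c x y} → Word c x y → Word (not c) x (a y)
  word-a {c} {x} (r-word k e) =
    s-word k (trans (cong a e) (trans (a-r^ k _) (cong (s ^ k) (a-a^ c x))))
  word-a {c} {x} (s-word k e) =
    r-word k (trans (cong a e) (trans (a-s^ k _) (cong (r ^ k) (a-a^ c x))))

  word-b : ∀ {c x y} → Word c x y → Word (not c) x (b y)
  word-b {c} {x} {y} (r-word k e) = s-word (suc k) (begin
    b y                     ≡⟨ cong b e ⟩
    b ((r ^ k) z)           ≡⟨ b-r^ k z ⟩
    (s ^ k) (b z)           ≡⟨ cong (s ^ k) b≡s∘a ⟩
    (s ^ k) (s (a z))       ≡⟨ ^-comm s k (a z) ⟩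
    (s ^ suc k) (a z)       ≡⟨ cong (s ^ suc k) (a-a^ c x) ⟩
    (s ^ suc k) (a^ (not c) x) ∎)
    where
      open ≡-Reasoning
      z = a^ c x
      b≡s∘a : b z ≡ s (a z)
      b≡s∘a = cong b (sym (a-inv z))
  word-b {c} {x} (s-word zero e) =
    s-word 1 (trans (cong b e) (trans (cong b (sym (a-inv _))) (cong s (a-a^ c x))))
  word-b {c} {x} {y} (s-word (suc k) e) = r-word k (begin
    b y                     ≡⟨ cong b e ⟩
    b ((s ^ suc k) z)       ≡⟨ b-s^ (suc k) z ⟩
    (r ^ suc k) (b z)       ≡⟨ ^-comm r k (b z) ⟨
    (r ^ k) (a (b (b z)))   ≡⟨ cong (λ t → (r ^ k) (a t)) (b-inv z) ⟩
    (r ^ k) (a z)           ≡⟨ cong (r ^ k) (a-a^ c x) ⟩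
    (r ^ k) (a^ (not c) x)  ∎)
    where
      open ≡-Reasoning
      z = a^ c x

  -- r^(k+2) a fixes x iff r^k a fixes s x.
  r^a-fixpoint-free : ∀ k x → x ≢ (r ^ k) (a x)
  r^a-fixpoint-free zero x e = a-fpf x (sym e)
  r^a-fixpoint-free (suc zero) x e =
    b-fpf (a x) (trans (sym (a-inv _)) (cong a (sym e)))
  r^a-fixpoint-free (suc (suc k)) x e =
    r^a-fixpoint-free k (s x) (trans (cong s e) (trans (s-r _) (sym (^-comm r k (a x)))))

  s^a-fixpoint-free : ∀ k x → x ≢ (s ^ k) (a x)
  s^a-fixpoint-free k x e = r^a-fixpoint-free k (a x) (trans (cong a e) (a-s^ k (a x)))

  closed-word-even : ∀ {c x} → Word c x x → c ≡ false
  closed-word-even {false} _ = refl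
  closed-word-even {true} {x} (r-word k e) = ⊥-elim (r^a-fixpoint-free k x e)
  closed-word-even {true} {x} (s-word k e) = ⊥-elim (s^a-fixpoint-free k x e)

vertex-of-nonbipartite : ∀ {n m} {M : Map n m} → ¬ Bipartite M → Fin n
vertex-of-nonbipartite {zero} {M = M} nb =
  ⊥-elim (nb ((λ ()) , λ x _ → ¬Fin0 (Map.vert M x)))
vertex-of-nonbipartite {suc n} _ = Fin.zero

module _ {n m : ℕ} (M : Map n m) where
  open Map M

  act : Gen → Fin N → Fin N
  act = act3 τ0 τ1 τ2

  VertexOrbit : Fin N → Fin N → Set
  VertexOrbit = Orbit act vertGen

  oddᵒ : ∀ {x y} → VertexOrbit x y → Bool
  oddᵒ here = false
  oddᵒ (step _ _ p) = not (oddᵒ p)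

  vert-act : ∀ g → vertGen g ≡ true → ∀ y → vert (act g y) ≡ vert y
  vert-act g1 _ = vert-τ1
  vert-act g2 _ = vert-τ2

  vertexOrbit-vert : ∀ {x y} → VertexOrbit x y → vert x ≡ vert y
  vertexOrbit-vert here = refl
  vertexOrbit-vert {x} (step g e p) = trans (sym (vert-act g e x)) (vertexOrbit-vert p)

  open Dihedral τ1 τ2 τ1-inv τ2-inv τ1-fpf τ2-fpf
    using (Word; word-refl; word-a; word-b; closed-word-even)

  word-++ : ∀ {c x y z} → Word c x y → (p : VertexOrbit y z) → Word (c xor oddᵒ p) x z
  word-++ {c} {x} {z = z} w here = subst (λ c′ → Word c′ x z) (sym (xor-identityʳ c)) w
  word-++ {c} {x} {z = z} w (step g1 _ p) =
    subst (λ c′ → Word c′ x z) (not-xor-swap c (oddᵒ p)) (word-++ (word-a w) p)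
  word-++ {c} {x} {z = z} w (step g2 _ p) =
    subst (λ c′ → Word c′ x z) (not-xor-swap c (oddᵒ p)) (word-++ (word-b w) p)

  round-trip-even : ∀ {x y} (p : VertexOrbit x y) (q : VertexOrbit y x) → oddᵒ p ≡ oddᵒ q
  round-trip-even {x} p q =
    xor≡false⇒≡ (closed-word-even (word-++ (word-++ (word-refl x) p) q))

  oddᵒ-unique : ∀ {x y y′} → y ≡ y′ → (p : VertexOrbit x y) (q : VertexOrbit x y′) →
                oddᵒ p ≡ oddᵒ q
  oddᵒ-unique {x} {y} refl p q =
    trans (round-trip-even p back) (sym (round-trip-even q back))
    where
      back : VertexOrbit y x
      back = vert-orb y x (sym (vertexOrbit-vert p))

  base : Fin n → Fin N
  base v = proj₁ (vert-surj v)

  toBase : ∀ y → VertexOrbit y (base (vert y))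
  toBase y = vert-orb y _ (sym (proj₂ (vert-surj (vert y))))

  localOrientation : LocalOrientation M
  localOrientation = σ , σ-flip g1 refl , σ-flip g2 refl
    where
      σ : Fin N → Bool
      σ y = oddᵒ (toBase y)

      σ-flip : ∀ g → vertGen g ≡ true → ∀ y → σ (act g y) ≡ not (σ y)
      σ-flip g e y =
        trans (sym (not-involutive _)) (cong not (sym (oddᵒ-unique
          (cong base (sym (vert-act g e y))) (toBase y) (step g e (toBase (act g y))))))

  data Walk : Fin n → Fin n → Set where
    []  : ∀ {u} → Walk u u
    _∷_ : ∀ {v} (x : Fin N) → Walk (vert (τ0 x)) v → Walk (vert x) v

  infixr 5 _∷_ _++_

  _++_ : ∀ {u v w} → Walk u v → Walk v w → Walk u w
  [] ++ q = q
  (x ∷ p) ++ q = x ∷ (p ++ q)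

  back : ∀ x → Walk (vert (τ0 x)) (vert x)
  back x = subst (Walk _) (cong vert (τ0-inv x)) (τ0 x ∷ [])

  reverse : ∀ {u v} → Walk u v → Walk v u
  reverse [] = []
  reverse (x ∷ p) = reverse p ++ back x

  fromOrbit : ∀ {x y} → Orbit act allGen x y → Walk (vert x) (vert y)
  fromOrbit here = []
  fromOrbit {x} (step g0 _ p) = x ∷ fromOrbit p
  fromOrbit {x} {y} (step g1 _ p) = subst (λ u → Walk u (vert y)) (vert-τ1 x) (fromOrbit p)
  fromOrbit {x} {y} (step g2 _ p) = subst (λ u → Walk u (vert y)) (vert-τ2 x) (fromOrbit p)

  walk : ∀ u v → Walk u v
  walk u v =
    subst₂ Walk (proj₂ (vert-surj u)) (proj₂ (vert-surj v)) (fromOrbit (connected _ _))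

  flags : ∀ {u v} → Walk u v → List (Fin N)
  flags [] = []
  flags (x ∷ p) = x ∷ flags p

  weight : (Fin N → Bool) → ∀ {u v} → Walk u v → Bool
  weight f [] = false
  weight f (x ∷ p) = f x xor weight f p

  odd : ∀ {u v} → Walk u v → Bool
  odd = weight (λ _ → true)

  τ0-Invariant : (Fin N → Bool) → Set
  τ0-Invariant f = ∀ x → f (τ0 x) ≡ f x

  weight-++ : ∀ f {u v w} (p : Walk u v) (q : Walk v w) →
              weight f (p ++ q) ≡ weight f p xor weight f q
  weight-++ f [] q = refl
  weight-++ f (x ∷ p) q =
    trans (cong (f x xor_) (weight-++ f p q)) (sym (xor-assoc (f x) _ _))

  weight-back : ∀ f x → weight f (back x) ≡ f (τ0 x)
  weight-back f x = trans (helper (cong vert (τ0-inv x)) (τ0 x ∷ [])) (xor-identityʳ _)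
    where
      helper : ∀ {v′} (e : vert (τ0 (τ0 x)) ≡ v′) (p : Walk (vert (τ0 x)) _) →
               weight f (subst (Walk _) e p) ≡ weight f p
      helper refl p = refl

  weight-reverse : ∀ {f} → τ0-Invariant f → ∀ {u v} (p : Walk u v) →
                   weight f (reverse p) ≡ weight f p
  weight-reverse f-inv [] = refl
  weight-reverse {f} f-inv (x ∷ p) = begin
    weight f (reverse p ++ back x)              ≡⟨ weight-++ f (reverse p) (back x) ⟩
    weight f (reverse p) xor weight f (back x)  ≡⟨ cong₂ _xor_ (weight-reverse f-inv p)
                                                               (weight-back f x) ⟩
    weight f p xor f (τ0 x)                     ≡⟨ cong (weight f p xor_) (f-inv x) ⟩
    weight f p xor f x                          ≡⟨ xor-comm (weight f p) (f x) ⟩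
    f x xor weight f p                          ∎
    where open ≡-Reasoning

  weight-not : ∀ f {u v} (p : Walk u v) → weight (λ x → not (f x)) p ≡ weight f p xor odd p
  weight-not f [] = refl
  weight-not f (x ∷ p) = begin
    not (f x) xor weight (λ y → not (f y)) p ≡⟨ cong (not (f x) xor_) (weight-not f p) ⟩
    not (f x) xor (weight f p xor odd p)     ≡⟨ not-distribˡ-xor (f x) _ ⟨
    not (f x xor (weight f p xor odd p))     ≡⟨ cong not (xor-assoc (f x) _ _) ⟨
    not ((f x xor weight f p) xor odd p)     ≡⟨ not-distribʳ-xor (f x xor weight f p) _ ⟩
    (f x xor weight f p) xor not (odd p)     ∎
    where open ≡-Reasoning

  weight-conjugate : ∀ {f} → τ0-Invariant f → ∀ {u w} (π : Walk u w) (C : Walk w w) →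
                     weight f (π ++ C ++ reverse π) ≡ weight f C
  weight-conjugate {f} f-inv π C = begin
    W (π ++ C ++ reverse π)            ≡⟨ weight-++ f π _ ⟩
    W π xor W (C ++ reverse π)         ≡⟨ cong (W π xor_) (weight-++ f C _) ⟩
    W π xor (W C xor W (reverse π))    ≡⟨ cong (λ t → W π xor (W C xor t)) (weight-reverse f-inv π) ⟩
    W π xor (W C xor W π)              ≡⟨ xor-cancel-outer (W C) (W π) false ⟩
    W C xor false                      ≡⟨ xor-identityʳ _ ⟩
    W C                                ∎
    where
      open ≡-Reasoning
      W : ∀ {u v} → Walk u v → Bool
      W = weight f

  splice : ∀ {u w} → Walk u u → Walk w w → Walk u u
  splice {u} {w} p C = p ++ walk u w ++ C ++ reverse (walk u w)

  weight-splice : ∀ {f} → τ0-Invariant f → ∀ {u w} (p : Walk u u) (C : Walk w w) →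
                  weight f (splice p C) ≡ weight f p xor weight f C
  weight-splice {f} f-inv {u} {w} p C =
    trans (weight-++ f p _) (cong (weight f p xor_) (weight-conjugate f-inv (walk u w) C))

  Conservative : (Fin N → Bool) → Set
  Conservative f = ∀ {u} (p : Walk u u) → weight f p ≡ false

  weight-path-independent : ∀ {f} → τ0-Invariant f → Conservative f →
                            ∀ {u v} (p q : Walk u v) → weight f p ≡ weight f q
  weight-path-independent {f} f-inv conservative p q = xor≡false⇒≡ (begin
    weight f p xor weight f q             ≡⟨ cong (weight f p xor_) (weight-reverse f-inv q) ⟨
    weight f p xor weight f (reverse q)   ≡⟨ weight-++ f p (reverse q) ⟨
    weight f (p ++ reverse q)             ≡⟨ conservative (p ++ reverse q) ⟩
    false                                 ∎)
    where open ≡-Reasoning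

  potential : Fin n → ∀ {f} → τ0-Invariant f → Conservative f →
              Σ (Fin n → Bool) λ pot → ∀ x → pot (vert (τ0 x)) ≡ pot (vert x) xor f x
  potential v₀ {f} f-inv conservative = pot , pot-step
    where
      pot : Fin n → Bool
      pot v = weight f (walk v₀ v)

      pot-step : ∀ x → pot (vert (τ0 x)) ≡ pot (vert x) xor f x
      pot-step x = begin
        weight f (walk v₀ (vert (τ0 x)))       ≡⟨ weight-path-independent {f} f-inv conservative
                                                    (walk v₀ (vert (τ0 x))) via-x ⟩
        weight f via-x                         ≡⟨ weight-++ f (walk v₀ (vert x)) (x ∷ []) ⟩
        pot (vert x) xor (f x xor false)       ≡⟨ cong (pot (vert x) xor_) (xor-identityʳ (f x)) ⟩
        pot (vert x) xor f x                   ∎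
        where
          open ≡-Reasoning
          via-x : Walk v₀ (vert (τ0 x))
          via-x = walk v₀ (vert x) ++ x ∷ []

  even-closed-walks⇒bipartite : Fin n → Conservative (λ _ → true) → Bipartite M
  even-closed-walks⇒bipartite v₀ even =
    let (colour , colour-step) = potential v₀ (λ _ → refl) even
    in colour , λ x e → not-¬ refl (trans e (trans (colour-step x) (xor-comm _ true)))

  parity-flags : ∀ f {u v} (p : Walk u v) → parity M (map f (flags p)) ≡ weight f p
  parity-flags f [] = refl
  parity-flags f (x ∷ p) = cong (f x xor_) (parity-flags f p)

  odd-length : ∀ (l : List (Fin N)) → parity M (map (λ _ → true) l) ≡ true → length l % 2 ≡ 1
  odd-length (x ∷ []) _ = refl
  odd-length (x ∷ y ∷ l) h = odd-length l (trans (sym (not-involutive _)) h)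

  linksTo : ∀ {u v} x (p : Walk u v) → vert (τ0 x) ≡ u → LinksTo M v x (flags p)
  linksTo x [] e = e
  linksTo x (y ∷ p) e = e , linksTo y p refl

  closedWalk : ∀ x → Walk (vert (τ0 x)) (vert x) → ClosedWalk M
  closedWalk x p = record { first = x ; rest = flags p ; links = linksTo x p refl }

  untwisted : (Fin N → Bool) → Fin N → Bool
  untwisted σ x = σ x xor σ (τ0 x)

  untwisted-τ0 : ∀ σ → τ0-Invariant (untwisted σ)
  untwisted-τ0 σ x =
    trans (cong (σ (τ0 x) xor_) (cong σ (τ0-inv x))) (xor-comm (σ (τ0 x)) (σ x))

  module _ (pc : ParityConsistent M) (lo : LocalOrientation M) where
    open Σ lo using () renaming (proj₁ to σ)

    odd-closed-walk-untwisted-even : ∀ {u} (p : Walk u u) → odd p ≡ true →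
                                     weight (untwisted σ) p ≡ false
    odd-closed-walk-untwisted-even (x ∷ p) odd-p = not-injective (begin
      not w                                       ≡⟨ xor-comm true w ⟩
      w xor true                                  ≡⟨ cong (w xor_) odd-p ⟨
      w xor odd (x ∷ p)                           ≡⟨ weight-not (untwisted σ) (x ∷ p) ⟨
      weight (twisted M σ) (x ∷ p)                ≡⟨ parity-flags (twisted M σ) (x ∷ p) ⟨
      parity M (map (twisted M σ) (x ∷ flags p))  ≡⟨ pc (closedWalk x p) oddLength lo ⟩
      true                                        ∎)
      where
        open ≡-Reasoning
        w = weight (untwisted σ) (x ∷ p)
        oddLength : OddWalk M (closedWalk x p)
        oddLength = odd-length (x ∷ flags p) (trans (parity-flags _ (x ∷ p)) odd-p)

    -- Splicing the odd closed walk C into an even closed walk makes it odd.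
    odd-closed-walk⇒untwisted-conservative : ∀ {w} (C : Walk w w) → odd C ≡ true →
                                             Conservative (untwisted σ)
    odd-closed-walk⇒untwisted-conservative C odd-C p with odd p in odd-p
    ... | true = odd-closed-walk-untwisted-even p odd-p
    ... | false = begin
      W p                  ≡⟨ xor-identityʳ _ ⟨
      W p xor false        ≡⟨ cong (W p xor_) (odd-closed-walk-untwisted-even C odd-C) ⟨
      W p xor W C          ≡⟨ weight-splice (untwisted-τ0 σ) p C ⟨
      W (splice p C)       ≡⟨ odd-closed-walk-untwisted-even (splice p C) odd-splice ⟩
      false                ∎
      where
        open ≡-Reasoning
        W : ∀ {u v} → Walk u v → Bool
        W = weight (untwisted σ)
        odd-splice : odd (splice p C) ≡ true
        odd-splice = trans (weight-splice (λ _ → refl) p C) (cong₂ _xor_ odd-p odd-C)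

    untwisted-conservative : ¬ Bipartite M → Conservative (untwisted σ)
    untwisted-conservative nb {u} p =
      decidable-stable (weight (untwisted σ) p ≟ false) λ p-unbalanced →
        nb (even-closed-walks⇒bipartite u λ C →
          ¬-not λ odd-C → p-unbalanced (odd-closed-walk⇒untwisted-conservative C odd-C p))

  switch : (σ : Fin N → Bool) (pot : Fin n → Bool) → Fin N → Bool
  switch σ pot y = σ y xor pot (vert y)

  switch-τ0 : ∀ σ pot → (∀ x → pot (vert (τ0 x)) ≡ pot (vert x) xor untwisted σ x) →
              ∀ x → switch σ pot (τ0 x) ≡ switch σ pot x
  switch-τ0 σ pot pot-step x =
    trans (cong (σ (τ0 x) xor_) (pot-step x))
          (xor-cancel-outer (σ x) (σ (τ0 x)) (pot (vert x)))

  switch-flip : ∀ (lo : LocalOrientation M) pot g → vertGen g ≡ true →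
                ∀ y → switch (proj₁ lo) pot (act g y) ≡ not (switch (proj₁ lo) pot y)
  switch-flip (σ , σ-τ1 , σ-τ2) pot g e y =
    trans (cong₂ _xor_ (flip g e) (cong pot (vert-act g e y)))
          (sym (not-distribˡ-xor (σ y) _))
    where
      flip : ∀ g → vertGen g ≡ true → σ (act g y) ≡ not (σ y)
      flip g1 _ = σ-τ1 y
      flip g2 _ = σ-τ2 y

  alternatingOrientation : (lo : LocalOrientation M) (pot : Fin n → Bool) →
                           (∀ x → pot (vert (τ0 x)) ≡ pot (vert x) xor untwisted (proj₁ lo) x) →
                           Σ (DualOrientation M) (Alternating M)
  alternatingOrientation lo pot pot-step =
    record { leaves = switch (proj₁ lo) pot
           ; leaves-τ0 = switch-τ0 (proj₁ lo) pot pot-step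
           ; leaves-τ2 = switch-flip lo pot g2 refl }
    , switch-flip lo pot g1 refl

lemma7p1 : ∀ {n m : ℕ} (M : Map n m) → TwoConnected M → Loopless M →
           ¬ Bipartite M → ParityConsistent M →
           Σ (DualOrientation M) (Alternating M)
lemma7p1 M _ _ nb pc =
  let lo = localOrientation M
      (pot , pot-step) = potential M (vertex-of-nonbipartite {M = M} nb)
                           (untwisted-τ0 M (proj₁ lo)) (untwisted-conservative M pc lo nb)
  in alternatingOrientation M lo pot pot-step
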